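{- A digraph $R\in\mathfrak{T}_a\cap\mathfrak{D}_r$ belongs to $\mathfrak{R}$ if and only if for every $G\in\mathfrak{T}_a$ with $h_G=h_R$: $$\mathcal{S}(G,R)\ne\emptyset\ \Longrightarrow\ \mathcal{M}^{\mathcal{L}(G)}(G,R)\cap\mathcal{S}(G,R)\ne\emptyset.$$
   Context: A digraph $G=(V(G),A(G))$ has finite nonempty vertex set and arc set $A(G)\subseteq V(G)\times V(G)$; $vw$ denotes $(v,w)$; $G^*$ is $G$ with loops removed. $\mathfrak{D}_r$: reflexive digraphs; $\mathfrak{T}_a$: digraphs with $G^*$ acyclic. $\mathcal{H}(G,H)$: homomorphisms; $\mathcal{S}(G,H)=\mathcal{H}(G,H)\cap\mathcal{H}(G^*,H^*)$: strict homomorphisms. Subgraph $L\subseteq G$: $V(L)\subseteq V(G)$, $A(L)\subseteq A(G)$; $\xi|_L$ is the restriction to $V(L)$. A path is a sequence $P_0,\dots,P_{\ell(P)}$ of distinct vertices with $P_{i-1}P_i\in A(G)$, of length $\ell(P)$ (in $G\in\mathfrak{T}_a$ identified with its vertex set). $h_G$: largest path length; $\mathcal{P}^h_G$: paths of length $h_G$. $P_\times$: digraph with vertex set $P$ and arcs $P_{i-1}P_i$; $\mathcal{L}(G)=\{P_\times:P\in\mathcal{P}^h_G\}$. $[v,w]_H=\{u:vu,uw\in A(H)\}$, $\iota(v,w)_H=\#[v,w]_H$; for $\xi\in\mathcal{H}(L,H)$, $\mu_\xi(L)=\sum_{vw\in A(L^*)}\iota(\xi(v),\xi(w))_H$; $\mathcal{M}(L,H)$: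 set of $\xi\in\mathcal{H}(L,H)$ maximizing $\mu_\xi(L)$; for a set $\mathcal{L}$ of subgraphs of $G$, $\mathcal{M}^{\mathcal{L}}(G,H)=\{\xi\in\mathcal{H}(G,H):\xi|_L\in\mathcal{M}(L,H)\ \forall L\in\mathcal{L}\}$. $\mathfrak{R}$: the class of $R\in\mathfrak{T}_a\cap\mathfrak{D}_r$ with $\mathcal{M}^{\mathcal{L}(R)}(R,R)\cap\mathcal{S}(R,R)\ne\emptyset$. -}

module Defs where

open import Data.Nat using (ℕ; zero; suc; _+_; _≤_)
open import Data.Fin using (Fin; inject₁) renaming (zero to fzero; suc to fsuc)
open import Data.Bool using (Bool; T; _∧_; if_then_else_)
open import Data.Product using (Σ; _×_; ∃)
open import Relation.Binary.PropositionalEquality using (_≡_; _≢_)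
open import Relation.Nullary using (¬_)
open import Function.Definitions using (Injective)
open import Function using (_∘_)

-- A digraph with finite nonempty vertex set Fin (suc size) and arc set
-- given by a Boolean adjacency function (any finite digraph is isomorphic to one).
record Digraph : Set where
  field
    size : ℕ
    arc  : Fin (suc size) → Fin (suc size) → Bool

V : Digraph → Set
V G = Fin (suc (Digraph.size G))

Arc : (G : Digraph) → V G → V G → Set
Arc G v w = T (Digraph.arc G v w)

Arc* : (G : Digraph) → V G → V G → Set
Arc* G v w = Arc G v w × v ≢ w

Reflexive : Digraph → Set
Reflexive G = ∀ v → Arc G v v

data Reach⁺ (G : Digraph) : V G → V G → Set where
  step  : ∀ {v w} → Arc* G v w → Reach⁺ G v w
  _then_ : ∀ {u v w} → Reach⁺ G u v → Reach⁺ G v w → Reach⁺ G u w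

Acyclic : Digraph → Set
Acyclic G = ∀ v → ¬ Reach⁺ G v v

IsHom : (G H : Digraph) → (V G → V H) → Set
IsHom G H ξ = ∀ v w → Arc G v w → Arc H (ξ v) (ξ w)

IsStrict : (G H : Digraph) → (V G → V H) → Set
IsStrict G H ξ = IsHom G H ξ × (∀ v w → Arc* G v w → Arc* H (ξ v) (ξ w))

record Path (G : Digraph) (ℓ : ℕ) : Set where
  field
    vtx  : Fin (suc ℓ) → V G
    inj  : Injective _≡_ _≡_ vtx
    arcs : ∀ (i : Fin ℓ) → Arc G (vtx (inject₁ i)) (vtx (fsuc i))

IsHeight : Digraph → ℕ → Set
IsHeight G h = Path G h × (∀ ℓ → Path G ℓ → ℓ ≤ h)

sumFin : (n : ℕ) → (Fin n → ℕ) → ℕ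
sumFin zero    f = 0
sumFin (suc n) f = f fzero + sumFin n (f ∘ fsuc)

ι : (H : Digraph) → V H → V H → ℕ
ι H v w = sumFin (suc (Digraph.size H))
  (λ u → if Digraph.arc H v u ∧ Digraph.arc H u w then 1 else 0)

-- A homomorphism P_× → H, for a path P of length ℓ, is given by its values
-- g i = image of P_i (P is injective), subject to g(i-1) g(i) ∈ A(H).
IsPathHom : (H : Digraph) (ℓ : ℕ) → (Fin (suc ℓ) → V H) → Set
IsPathHom H ℓ g = ∀ (i : Fin ℓ) → Arc H (g (inject₁ i)) (g (fsuc i))

-- μ_g(P_×) = Σ_{vw ∈ A(P_×*)} ι(g v, g w) = Σ_{i=1}^{ℓ} ι(g(P_{i-1}), g(P_i))
μ : (H : Digraph) (ℓ : ℕ) → (Fin (suc ℓ) → V H) → ℕ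
μ H ℓ g = sumFin ℓ (λ i → ι H (g (inject₁ i)) (g (fsuc i)))

InML : (G H : Digraph) → (V G → V H) → Set
InML G H ξ = IsHom G H ξ ×
  (∀ h → IsHeight G h → ∀ (P : Path G h) → ∀ (g : Fin (suc h) → V H) →
     IsPathHom H h g → μ H h g ≤ μ H h (ξ ∘ Path.vtx P))

GoodMap : Digraph → Digraph → Set
GoodMap G H = Σ (V G → V H) (λ ξ → InML G H ξ × IsStrict G H ξ)

HasStrict : Digraph → Digraph → Set
HasStrict G H = Σ (V G → V H) (IsStrict G H)

SameHeight : Digraph → Digraph → Set
SameHeight G H = ∃ (λ h → IsHeight G h × IsHeight H h)

InClassR : Digraph → Set
InClassR R = Acyclic R × Reflexive R × GoodMap R R

module Submission where

-- Fix R ∈ 𝔗_a ∩ 𝔇_r.  Two general facts drive the proof.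
--  * A strict homomorphism σ : G → R into an acyclic digraph maps every path
--    of G to a path of R of the same length: consecutive images are joined by
--    non-loop arcs, so an equality σ(P_i) = σ(P_j) with i < j would close a
--    directed cycle in R*.  Hence, when h_G = h_R, σ maps ℒ(G) into ℒ(R).
--  * Every digraph has a height: path lengths are bounded by the number of
--    vertices, and having a path of a given length is decidable (a search over
--    the finitely many vertex sequences), so the largest one can be found.
-- (⇒) If ξ ∈ ℳ^{ℒ(R)}(R,R) ∩ 𝒮(R,R) and σ ∈ 𝒮(G,R) with h_G = h_R, then
--     ξ ∘ σ is strict, and on each P ∈ 𝒫^h_G it equals ξ on the path σ(P) ∈
--     𝒫^h_R, where ξ is μ-maximal; so ξ ∘ σ ∈ ℳ^{ℒ(G)}(G,R) ∩ 𝒮(G,R).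
-- (⇐) Apply the hypothesis to G = R with the identity map, which is strict;
--     the height of R provides h_G = h_R.

open import Defs
open import Function using (_∘_; id)
open import Function.Bundles using (_⇔_; mk⇔)
open import Data.Nat using (ℕ; zero; suc; _≤_; z<s; s<s⁻¹)
open import Data.Nat.Properties using (≤-antisym; ≤-pred; ≤∧≢⇒<)
open import Data.Fin using (Fin; inject₁; _<_) renaming (zero to fzero; suc to fsuc)
open import Data.Fin.Properties
  using (any?; all?; <-cmp; injective⇒≤; suc-injective) renaming (_≟_ to _≟ᶠ_)
open import Data.Vec.Functional using (_∷_)
open import Data.Bool.Properties using (T?)
open import Data.Product using (Σ; _×_; _,_; proj₁; ∃)
open import Data.Empty using (⊥-elim)
open import Relation.Nullary using (Dec; yes; no; _→-dec_; _×-dec_)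
open import Relation.Binary.PropositionalEquality using (_≡_; _≢_; refl; sym; trans; subst)
open import Relation.Binary.Definitions using (tri<; tri≈; tri>)

reach-along : (G : Digraph) (ℓ : ℕ) (f : Fin (suc ℓ) → V G) →
  (∀ (i : Fin ℓ) → Arc* G (f (inject₁ i)) (f (fsuc i))) →
  ∀ {i j : Fin (suc ℓ)} → i < j → Reach⁺ G (f i) (f j)
reach-along G (suc ℓ) f arcs {fzero} {fsuc fzero} _ = step (arcs fzero)
reach-along G (suc ℓ) f arcs {fzero} {fsuc (fsuc j)} _ =
  step (arcs fzero) then reach-along G ℓ (f ∘ fsuc) (arcs ∘ fsuc) {fzero} {fsuc j} z<s
reach-along G (suc ℓ) f arcs {fsuc i} {fsuc j} i<j =
  reach-along G ℓ (f ∘ fsuc) (arcs ∘ fsuc) (s<s⁻¹ i<j)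

inject₁≢suc : ∀ {ℓ} (i : Fin ℓ) → inject₁ i ≢ fsuc i
inject₁≢suc (fsuc i) eq = inject₁≢suc i (suc-injective eq)

acyclic⇒injective : (R : Digraph) → Acyclic R → (ℓ : ℕ) (f : Fin (suc ℓ) → V R) →
  (∀ (i : Fin ℓ) → Arc* R (f (inject₁ i)) (f (fsuc i))) →
  ∀ {i j} → f i ≡ f j → i ≡ j
acyclic⇒injective R acR ℓ f arcs {i} {j} fi≡fj with <-cmp i j
... | tri< i<j _ _ = ⊥-elim (acR (f i) (subst (Reach⁺ R (f i)) (sym fi≡fj) (reach-along R ℓ f arcs i<j)))
... | tri≈ _ i≡j _ = i≡j
... | tri> _ _ j<i = ⊥-elim (acR (f j) (subst (Reach⁺ R (f j)) fi≡fj (reach-along R ℓ f arcs j<i)))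

strict-image : (G R : Digraph) → Acyclic R → (σ : V G → V R) → IsStrict G R σ →
  ∀ {ℓ} → Path G ℓ → Path R ℓ
strict-image G R acR σ (_ , σ*) {ℓ} P = record
  { vtx  = σ ∘ vtx
  ; inj  = acyclic⇒injective R acR ℓ (σ ∘ vtx) image-arcs
  ; arcs = proj₁ ∘ image-arcs
  }
  where
  open Path P
  image-arcs : ∀ i → Arc* R (σ (vtx (inject₁ i))) (σ (vtx (fsuc i)))
  image-arcs i = σ* _ _ (arcs i , inject₁≢suc i ∘ inj)

height-unique : (G : Digraph) → ∀ {h h′} → IsHeight G h → IsHeight G h′ → h ≡ h′
height-unique G (P , maxP) (P′ , maxP′) = ≤-antisym (maxP′ _ P) (maxP _ P′)

decide-∃-function : ∀ m k (P : (Fin m → Fin k) → Set) →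
  (∀ f g → (∀ i → f i ≡ g i) → P f → P g) → (∀ f → Dec (P f)) → Dec (Σ _ P)
decide-∃-function zero k P resp P? with P? (λ ())
... | yes p = yes (_ , p)
... | no ¬p = no λ (f , pf) → ¬p (resp f _ (λ ()) pf)
decide-∃-function (suc m) k P resp P?
  with any? (λ a → decide-∃-function m k (P ∘ (a ∷_)) (resp-tail a) (P? ∘ (a ∷_)))
  where
  resp-tail : ∀ a f g → (∀ i → f i ≡ g i) → P (a ∷ f) → P (a ∷ g)
  resp-tail a f g f≗g = resp (a ∷ f) (a ∷ g) λ { fzero → refl ; (fsuc i) → f≗g i }
... | yes (a , f , p) = yes (a ∷ f , p)
... | no ¬p = no λ (f , pf) →
  ¬p (f fzero , f ∘ fsuc , resp f _ (λ { fzero → refl ; (fsuc i) → refl }) pf)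

path? : (G : Digraph) (ℓ : ℕ) → Dec (Path G ℓ)
path? G ℓ with decide-∃-function (suc ℓ) (suc (Digraph.size G)) IsPath respects is-path?
  where
  IsPath : (Fin (suc ℓ) → V G) → Set
  IsPath f = (∀ i j → f i ≡ f j → i ≡ j) × (∀ i → Arc G (f (inject₁ i)) (f (fsuc i)))
  respects : ∀ f g → (∀ i → f i ≡ g i) → IsPath f → IsPath g
  respects f g f≗g (inj , arcs) =
    (λ i j gi≡gj → inj i j (trans (f≗g i) (trans gi≡gj (sym (f≗g j))))) ,
    (λ i → subst (λ x → Arc G x (g (fsuc i))) (f≗g (inject₁ i))
             (subst (Arc G (f (inject₁ i))) (f≗g (fsuc i)) (arcs i)))
  is-path? : ∀ f → Dec (IsPath f)
  is-path? f = all? (λ i → all? (λ j → (f i ≟ᶠ f j) →-dec (i ≟ᶠ j)))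
               ×-dec all? (λ i → T? (Digraph.arc G (f (inject₁ i)) (f (fsuc i))))
... | yes (f , inj , arcs) = yes (record { vtx = f ; inj = inj _ _ ; arcs = arcs })
... | no ¬p = no λ P → ¬p (Path.vtx P , (λ _ _ → Path.inj P) , Path.arcs P)

trivial-path : (G : Digraph) → Path G 0
trivial-path G = record { vtx = λ _ → fzero ; inj = λ { {fzero} {fzero} _ → refl } ; arcs = λ () }

height-below : (G : Digraph) (k : ℕ) → (∀ ℓ → Path G ℓ → ℓ ≤ k) → ∃ (IsHeight G)
height-below G k bound with path? G k
... | yes P = k , P , bound
height-below G zero    bound | no ¬P = ⊥-elim (¬P (trivial-path G))
height-below G (suc k) bound | no ¬P =
  height-below G k λ ℓ P → ≤-pred (≤∧≢⇒< (bound ℓ P) λ { refl → ¬P P })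

-- Every digraph has a height: a path has at most as many vertices as G.
height-exists : (G : Digraph) → ∃ (IsHeight G)
height-exists G = height-below G (Digraph.size G) λ ℓ P → ≤-pred (injective⇒≤ (Path.inj P))

∘-hom : (G H K : Digraph) (σ : V G → V H) (ξ : V H → V K) →
  IsHom G H σ → IsHom H K ξ → IsHom G K (ξ ∘ σ)
∘-hom G H K σ ξ σ-hom ξ-hom v w vw = ξ-hom _ _ (σ-hom v w vw)

∘-strict : (G H K : Digraph) (σ : V G → V H) (ξ : V H → V K) →
  IsStrict G H σ → IsStrict H K ξ → IsStrict G K (ξ ∘ σ)
∘-strict G H K σ ξ (σ-hom , σ*) (ξ-hom , ξ*) =
  ∘-hom G H K σ ξ σ-hom ξ-hom , λ v w vw → ξ* _ _ (σ* v w vw)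

-- If ξ ∈ ℳ^{ℒ(R)}(R,R) ∩ 𝒮(R,R), σ ∈ 𝒮(G,R) and h_G = h_R, then
-- ξ ∘ σ ∈ ℳ^{ℒ(G)}(G,R) ∩ 𝒮(G,R): on P ∈ 𝒫^h_G it is ξ on σ(P) ∈ 𝒫^h_R.
good-after-strict : (G R : Digraph) → Acyclic R → ∀ {h} → IsHeight G h → IsHeight R h →
  (ξ : V R → V R) → InML R R ξ → IsStrict R R ξ →
  (σ : V G → V R) → IsStrict G R σ → GoodMap G R
good-after-strict G R acR {h} hG hR ξ (ξ-hom , ξ-max) ξ-strict σ σ-strict =
  ξ ∘ σ , (∘-hom G R R σ ξ (proj₁ σ-strict) ξ-hom , maximal) , ∘-strict G R R σ ξ σ-strict ξ-strict
  where
  maximal : ∀ h′ → IsHeight G h′ → (P : Path G h′) (g : Fin (suc h′) → V R) →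
    IsPathHom R h′ g → μ R h′ g ≤ μ R h′ (ξ ∘ σ ∘ Path.vtx P)
  maximal h′ hG′ with height-unique G hG′ hG
  ... | refl = λ P → ξ-max h hR (strict-image G R acR σ σ-strict P)

lemma7 : (R : Digraph) → Acyclic R → Reflexive R →
    (InClassR R ⇔ (∀ (G : Digraph) → Acyclic G → SameHeight G R →
    HasStrict G R → GoodMap G R))
lemma7 R acR reflR = mk⇔ forward backward
  where
  forward : InClassR R → ∀ G → Acyclic G → SameHeight G R → HasStrict G R → GoodMap G R
  forward (_ , _ , ξ , ξ-max , ξ-strict) G _ (h , hG , hR) (σ , σ-strict) =
    good-after-strict G R acR hG hR ξ ξ-max ξ-strict σ σ-strict
  backward : (∀ G → Acyclic G → SameHeight G R → HasStrict G R → GoodMap G R) → InClassR R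
  backward good with height-exists R
  ... | h , hR = acR , reflR , good R acR (h , hR , hR) (id , (λ _ _ a → a) , (λ _ _ a → a))
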